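{- Let $G$ be a graph containing a clique $K$ such that $N(\{v\})\setminus K=N(\{w\})\setminus K$ for all $v,w\in K$, and let $S$ be a winning $m$-strategy for $G$ of length $T$. Then there exists a winning $m$-strategy $S'=(F'_1,\dots,F'_T)$ for $G$ of length $T$ such that for all $i\in[T]$ and all $v\in K$: $v\in F'_i$ if and only if $K\subseteq F'_i$.
   Context: All graphs are finite, simple and undirected. For a graph $G=(V,E)$ and $W\subseteq V$, $N(W)$ is the set of nodes in $V\setminus W$ adjacent to at least one node of $W$. For $m\in\mathbb{N}_{>0}$, an $m$-strategy of length $T$ is a sequence $(F_1,\dots,F_T)$ of subsets of $V$ with $|F_i|\le m$. Its burning sets are $B_0=V$ and $B_t=(B_{t-1}\setminus F_t)\cup N(B_{t-1}\setminus F_t)$ for $t\ge1$, where $F_t=\emptyset$ for $t>T$. The strategy is winning if $B_T=\emptyset$. -}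

module Defs where

open import Data.Nat using (ℕ; zero; suc; _≤_; _>_)
open import Data.Bool using (Bool; true; false; not; _∧_; _∨_)
open import Data.Fin using (Fin; zero; suc)
open import Data.Fin.Subset using (Subset; ⊤; ⊥; _∪_; _─_; _∈_; _⊆_; ∣_∣; ⁅_⁆)
open import Data.Vec using (Vec; []; _∷_; tabulate; lookup)
open import Data.Vec.Relation.Unary.All using (All)
open import Relation.Binary.PropositionalEquality using (_≡_; _≢_)
open import Relation.Nullary using (¬_)

record Graph (n : ℕ) : Set where
  field
    adj   : Fin n → Fin n → Bool
    sym   : ∀ u v → adj u v ≡ adj v u
    irrefl : ∀ v → adj v v ≡ false
open Graph public

anyFin : ∀ {n} → (Fin n → Bool) → Bool
anyFin {zero}  p = false
anyFin {suc n} p = p zero ∨ anyFin (λ i → p (suc i))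

N : ∀ {n} → Graph n → Subset n → Subset n
N G W = tabulate λ u → not (lookup W u) ∧ anyFin (λ w → lookup W w ∧ adj G u w)

step : ∀ {n} → Graph n → Subset n → Subset n → Subset n
step G B F = (B ─ F) ∪ N G (B ─ F)

burnFrom : ∀ {n T} → Graph n → Subset n → Vec (Subset n) T → Subset n
burnFrom G B []       = B
burnFrom G B (F ∷ Fs) = burnFrom G (step G B F) Fs

burning : ∀ {n T} → Graph n → Vec (Subset n) T → Subset n
burning G S = burnFrom G ⊤ S

IsStrategy : ∀ {n T} → ℕ → Vec (Subset n) T → Set
IsStrategy m S = All (λ F → ∣ F ∣ ≤ m) S

IsWinning : ∀ {n T} → Graph n → ℕ → Vec (Subset n) T → Set
IsWinning G m S = IsStrategy m S × burning G S ≡ ⊥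
  where open import Data.Product using (_×_)

IsClique : ∀ {n} → Graph n → Subset n → Set
IsClique G K = ∀ v w → v ∈ K → w ∈ K → v ≢ w → adj G v w ≡ true

{-# OPTIONS --safe #-}
-- Normalise the strategy by replacing every F that does not contain all of K by F ─ K.
-- The twin condition makes K ∪ N(K) the closed neighbourhood of each vertex of K, so a
-- burning set produced by a step either contains K or misses it. If B misses K, protecting
-- vertices of K has no effect on B ─ F; if K ⊆ B and some u ∈ K is left unprotected, the
-- fire at u alone already reaches K ∪ N(K), so protecting the rest of K has no effect
-- either. The normalised strategy therefore yields the same burning sets with smaller F's.
module Submission where

open import Defs hiding (sym)
open import Data.Nat using (ℕ; suc; _>_)
open import Data.Nat.Properties using (≤-trans)
open import Data.Bool using (Bool; true; false; not; _∧_; _∨_)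
open import Data.Bool.Properties using (∨-zeroʳ; ∧-conicalˡ; ∧-conicalʳ; ¬-not)
open import Data.Fin using (Fin; zero; suc; _≟_)
open import Data.Fin.Subset
  using (Subset; outside; _∈_; _∉_; _⊆_; _─_; _∪_; ⁅_⁆; Empty)
open import Data.Fin.Subset.Properties
  using (_∈?_; nonempty?; ∈⊤; x∈⁅x⁆; x∈⁅y⁆⇒x≡y; x≢y⇒x∉⁅y⁆; x∈p∪q⁺; x∈p∪q⁻;
         x∈p∧x∉q⇒x∈p─q; p─q⊆p; drop-there; ⊆-antisym; p⊆q⇒∣p∣≤∣q∣)
open import Data.Vec using (Vec; []; _∷_; lookup; map; here; there)
open import Data.Vec.Properties using ([]=⇒lookup; lookup⇒[]=; lookup∘tabulate; lookup-map)
open import Data.Vec.Relation.Unary.All as All using ()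
open import Data.Vec.Relation.Unary.All.Properties using (map⁺)
open import Data.Product using (Σ; ∃-syntax; _×_; _,_)
open import Data.Sum using (_⊎_; inj₁; inj₂)
open import Function using (_∘_)
open import Relation.Binary.PropositionalEquality
  using (_≡_; _≢_; refl; sym; trans; cong; cong₂; subst; module ≡-Reasoning)
open import Relation.Nullary using (yes; no; contradiction)

anyFin-true⁺ : ∀ {n} (p : Fin n → Bool) i → p i ≡ true → anyFin p ≡ true
anyFin-true⁺ p zero    pi≡true rewrite pi≡true = refl
anyFin-true⁺ p (suc i) pi≡true =
  trans (cong (p zero ∨_) (anyFin-true⁺ (p ∘ suc) i pi≡true)) (∨-zeroʳ (p zero))

anyFin-true⁻ : ∀ {n} (p : Fin n → Bool) → anyFin p ≡ true → ∃[ i ] p i ≡ true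
anyFin-true⁻ {suc n} p any≡true with p zero in p0≡true
... | true  = zero , p0≡true
... | false with anyFin-true⁻ (p ∘ suc) any≡true
...   | i , pi≡true = suc i , pi≡true

x∈p─q⇒x∉q : ∀ {n} {x : Fin n} {p q : Subset n} → x ∈ p ─ q → x ∉ q
x∈p─q⇒x∉q {p = _ ∷ _} {q = outside ∷ _} here ()
x∈p─q⇒x∉q {p = _ ∷ _} {q = _ ∷ _} (there x∈p─q) x∈q = x∈p─q⇒x∉q x∈p─q (drop-there x∈q)

module _ {n} {p q r : Subset n} where

  p─[q─r]⊆[p─q]∪r : p ─ (q ─ r) ⊆ (p ─ q) ∪ r
  p─[q─r]⊆[p─q]∪r {x} x∈p─[q─r] with x ∈? r
  ... | yes x∈r = x∈p∪q⁺ (inj₂ x∈r)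
  ... | no  x∉r = x∈p∪q⁺ (inj₁ (x∈p∧x∉q⇒x∈p─q (p─q⊆p p (q ─ r) x∈p─[q─r]) x∉q))
    where
    x∉q : x ∉ q
    x∉q x∈q = x∈p─q⇒x∉q x∈p─[q─r] (x∈p∧x∉q⇒x∈p─q x∈q x∉r)

  ─-antitoneʳ : r ⊆ q → p ─ q ⊆ p ─ r
  ─-antitoneʳ r⊆q x∈p─q = x∈p∧x∉q⇒x∈p─q (p─q⊆p p q x∈p─q) (x∈p─q⇒x∉q x∈p─q ∘ r⊆q)

Empty[p─q]⇒p⊆q : ∀ {n} {p q : Subset n} → Empty (p ─ q) → p ⊆ q
Empty[p─q]⇒p⊆q {q = q} empty {x} x∈p with x ∈? q
... | yes x∈q = x∈q
... | no  x∉q = contradiction (x , x∈p∧x∉q⇒x∈p─q x∈p x∉q) empty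

module _ {n} (G : Graph n) where

  Near : Fin n → Fin n → Set
  Near x u = x ≡ u ⊎ adj G x u ≡ true

  Near-sym : ∀ {x u} → Near x u → Near u x
  Near-sym (inj₁ x≡u) = inj₁ (sym x≡u)
  Near-sym (inj₂ x∼u) = inj₂ (trans (Graph.sym G _ _) x∼u)

  x∈N⁺ : ∀ {W x w} → x ∉ W → w ∈ W → adj G x w ≡ true → x ∈ N G W
  x∈N⁺ {W} {x} {w} x∉W w∈W x∼w = lookup⇒[]= x (N G W) (begin
    lookup (N G W) x                                 ≡⟨ lookup∘tabulate _ x ⟩
    not (lookup W x) ∧ anyFin (λ y → lookup W y ∧ adj G x y)
      ≡⟨ cong₂ _∧_ (cong not (¬-not (x∉W ∘ lookup⇒[]= x W)))
                    (anyFin-true⁺ _ w (cong₂ _∧_ ([]=⇒lookup w∈W) x∼w)) ⟩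
    true                                             ∎)
    where open ≡-Reasoning

  x∈N⁻ : ∀ {W x} → x ∈ N G W → ∃[ w ] w ∈ W × adj G x w ≡ true
  x∈N⁻ {W} {x} x∈N
    with anyFin-true⁻ _ (∧-conicalʳ _ _ (trans (sym (lookup∘tabulate _ x)) ([]=⇒lookup x∈N)))
  ... | w , w∈W∧x∼w = w , lookup⇒[]= w W (∧-conicalˡ _ _ w∈W∧x∼w) , ∧-conicalʳ _ _ w∈W∧x∼w

  closedN : Subset n → Subset n
  closedN D = D ∪ N G D

  x∈closedN⁺ : ∀ {D x u} → u ∈ D → Near x u → x ∈ closedN D
  x∈closedN⁺ u∈D (inj₁ refl) = x∈p∪q⁺ (inj₁ u∈D)
  x∈closedN⁺ {D} {x} u∈D (inj₂ x∼u) with x ∈? D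
  ... | yes x∈D = x∈p∪q⁺ (inj₁ x∈D)
  ... | no  x∉D = x∈p∪q⁺ (inj₂ (x∈N⁺ x∉D u∈D x∼u))

  x∈closedN⁻ : ∀ {D x} → x ∈ closedN D → ∃[ u ] u ∈ D × Near x u
  x∈closedN⁻ {D} {x} x∈closedN with x∈p∪q⁻ D (N G D) x∈closedN
  ... | inj₁ x∈D = x , x∈D , inj₁ refl
  ... | inj₂ x∈ND with x∈N⁻ x∈ND
  ...   | u , u∈D , x∼u = u , u∈D , inj₂ x∼u

  closedN-mono : ∀ {D D′} → D ⊆ D′ → closedN D ⊆ closedN D′
  closedN-mono D⊆D′ x∈closedN with x∈closedN⁻ x∈closedN
  ... | u , u∈D , x≈u = x∈closedN⁺ (D⊆D′ u∈D) x≈u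

module TwinClique {n} (G : Graph n) (K : Subset n) (clique : IsClique G K)
  (twins : ∀ v w → v ∈ K → w ∈ K → N G ⁅ v ⁆ ─ K ≡ N G ⁅ w ⁆ ─ K) where

  ∉K⇒≢ : ∀ {x v} → x ∉ K → v ∈ K → x ≢ v
  ∉K⇒≢ x∉K v∈K refl = x∉K v∈K

  adj-transfer : ∀ {x v w} → x ∉ K → v ∈ K → w ∈ K → adj G x v ≡ true → adj G x w ≡ true
  adj-transfer {x} {v} {w} x∉K v∈K w∈K x∼v with x∈N⁻ G (p─q⊆p _ K x∈N[w]─K)
    where
    x∈N[w]─K : x ∈ N G ⁅ w ⁆ ─ K
    x∈N[w]─K = subst (x ∈_) (twins v w v∈K w∈K)
      (x∈p∧x∉q⇒x∈p─q (x∈N⁺ G (x≢y⇒x∉⁅y⁆ (∉K⇒≢ x∉K v∈K)) (x∈⁅x⁆ v) x∼v) x∉K)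
  ... | w′ , w′∈⁅w⁆ , x∼w′ = subst (λ y → adj G x y ≡ true) (x∈⁅y⁆⇒x≡y w w′∈⁅w⁆) x∼w′

  Near-clique : ∀ {x v w} → v ∈ K → w ∈ K → Near G x v → Near G x w
  Near-clique {x} {v} {w} v∈K w∈K x≈v with x ≟ w | x ∈? K | x≈v
  ... | yes x≡w | _       | _          = inj₁ x≡w
  ... | no  x≢w | yes x∈K | _          = inj₂ (clique x w x∈K w∈K x≢w)
  ... | no  _   | no  x∉K | inj₁ x≡v   = contradiction x≡v (∉K⇒≢ x∉K v∈K)
  ... | no  _   | no  x∉K | inj₂ x∼v   = inj₂ (adj-transfer x∉K v∈K w∈K x∼v)

  Homogeneous : Subset n → Set
  Homogeneous B = ∀ {v w} → v ∈ K → w ∈ K → v ∈ B → w ∈ B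

  closedN-homogeneous : ∀ D → Homogeneous (closedN G D)
  closedN-homogeneous D v∈K w∈K v∈closedN with x∈closedN⁻ G v∈closedN
  ... | u , u∈D , v≈u = x∈closedN⁺ G u∈D (Near-sym G (Near-clique v∈K w∈K (Near-sym G v≈u)))

  closedN-absorbs : ∀ {D u} → u ∈ K → u ∈ D → closedN G (D ∪ K) ⊆ closedN G D
  closedN-absorbs {D} u∈K u∈D x∈closedN with x∈closedN⁻ G x∈closedN
  ... | w , w∈D∪K , x≈w with x∈p∪q⁻ D K w∈D∪K
  ...   | inj₁ w∈D = x∈closedN⁺ G w∈D x≈w
  ...   | inj₂ w∈K = x∈closedN⁺ G u∈D (Near-clique w∈K u∈K x≈w)

  normalise : Subset n → Subset n
  normalise F with nonempty? (K ─ F)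
  ... | yes _ = F ─ K
  ... | no  _ = F

  normalise-⊆ : ∀ F → normalise F ⊆ F
  normalise-⊆ F with nonempty? (K ─ F)
  ... | yes _ = p─q⊆p F K
  ... | no  _ = λ x∈F → x∈F

  AllOrNothing : Subset n → Set
  AllOrNothing F = ∀ v → v ∈ K → (v ∈ F → K ⊆ F) × (K ⊆ F → v ∈ F)

  normalise-all-or-nothing : ∀ F → AllOrNothing (normalise F)
  normalise-all-or-nothing F v v∈K with nonempty? (K ─ F)
  ... | yes _     = (λ v∈F─K → contradiction v∈K (x∈p─q⇒x∉q v∈F─K)) , λ K⊆F─K → K⊆F─K v∈K
  ... | no  empty = (λ _ → Empty[p─q]⇒p⊆q empty) , λ K⊆F → K⊆F v∈K

  step-normalise : ∀ {B} → Homogeneous B → ∀ F → step G B (normalise F) ≡ step G B F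
  step-normalise {B} hom F with nonempty? (K ─ F)
  ... | no  _ = refl
  ... | yes (u , u∈K─F) with u ∈? B
  ...   | yes u∈B = ⊆-antisym
          (closedN-absorbs (p─q⊆p K F u∈K─F) u∈B─F ∘ closedN-mono G p─[q─r]⊆[p─q]∪r)
          (closedN-mono G (─-antitoneʳ (p─q⊆p F K)))
    where
    u∈B─F : u ∈ B ─ F
    u∈B─F = x∈p∧x∉q⇒x∈p─q u∈B (x∈p─q⇒x∉q u∈K─F)
  ...   | no  u∉B = cong (closedN G) (⊆-antisym B─[F─K]⊆B─F (─-antitoneʳ (p─q⊆p F K)))
    where
    B─[F─K]⊆B─F : B ─ (F ─ K) ⊆ B ─ F
    B─[F─K]⊆B─F x∈B─[F─K] with x∈p∪q⁻ (B ─ F) K (p─[q─r]⊆[p─q]∪r x∈B─[F─K])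
    ... | inj₁ x∈B─F = x∈B─F
    ... | inj₂ x∈K   = contradiction (hom x∈K (p─q⊆p K F u∈K─F) (p─q⊆p B _ x∈B─[F─K])) u∉B

  burnFrom-normalise : ∀ {B T} → Homogeneous B → (S : Vec (Subset n) T) →
                       burnFrom G B (map normalise S) ≡ burnFrom G B S
  burnFrom-normalise hom []      = refl
  burnFrom-normalise {B} hom (F ∷ S) = begin
    burnFrom G (step G B (normalise F)) (map normalise S)
      ≡⟨ cong (λ B′ → burnFrom G B′ (map normalise S)) (step-normalise hom F) ⟩
    burnFrom G (step G B F) (map normalise S)
      ≡⟨ burnFrom-normalise (closedN-homogeneous (B ─ F)) S ⟩
    burnFrom G (step G B F) S
      ∎
    where open ≡-Reasoning

  normalise-strategy : ∀ {m T} {S : Vec (Subset n) T} →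
                       IsStrategy m S → IsStrategy m (map normalise S)
  normalise-strategy = map⁺ ∘ All.map (λ {F} ∣F∣≤m → ≤-trans (p⊆q⇒∣p∣≤∣q∣ (normalise-⊆ F)) ∣F∣≤m)

lemma3 : ∀ {n} (G : Graph n) (m T : ℕ) → m > 0 →
    (K : Subset n) → IsClique G K →
    (∀ v w → v ∈ K → w ∈ K → N G ⁅ v ⁆ ─ K ≡ N G ⁅ w ⁆ ─ K) →
    (S : Vec (Subset n) T) → IsWinning G m S →
    Σ (Vec (Subset n) T) λ S′ → IsWinning G m S′ ×
      (∀ (i : Fin T) v → v ∈ K → (v ∈ lookup S′ i → K ⊆ lookup S′ i) × (K ⊆ lookup S′ i → v ∈ lookup S′ i))
lemma3 G _ _ _ K clique twins S (strategy , wins) =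
  map normalise S ,
  (normalise-strategy strategy , trans (burnFrom-normalise (λ _ _ _ → ∈⊤) S) wins) ,
  λ i → subst AllOrNothing (sym (lookup-map i normalise S)) (normalise-all-or-nothing (lookup S i))
  where open TwinClique G K clique twins
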